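{- Let $n$ be even and $F\colon\mathbb F_2^n\to\mathbb F_2^n$ a plateaued APN function. Then the number of bent component functions $F_b$, $b\in\mathbb F_2^n\setminus\{0\}$, is congruent to $2$ modulo $4$.
   Context: Scalar product $\langle x,y\rangle=\sum x_iy_i$; components $F_b(x)=\langle b,F(x)\rangle$; $W_f(a)=\sum_x(-1)^{f(x)+\langle a,x\rangle}$. $f$ is $t$-plateaued if $|W_f(a)|\in\{0,2^{(n+t)/2}\}$ for all $a$, bent if $|W_f(a)|=2^{n/2}$ for all $a$. $F$ is plateaued if each $F_b$, $b\ne0$, is $s_b$-plateaued for some $s_b$. $F$ is APN if for all $a\ne0$ and all $b$ the equation $F(x+a)+F(x)=b$ has at most $2$ solutions. -}

module Defs where

open import Data.Bool using (Bool; true; false; _xor_; _∧_; if_then_else_)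
open import Data.Nat using (ℕ; zero; suc; _+_; _*_; _^_; _≤_)
open import Data.Integer as ℤ using (ℤ; ∣_∣)
open import Data.List using (List; []; _∷_; map; concatMap; foldr; length; filter)
open import Data.List.Relation.Unary.All using (All; all?)
open import Data.Vec using (Vec; []; _∷_; zipWith; replicate)
open import Data.Product using (∃; _×_; _,_)
open import Data.Sum using (_⊎_)
open import Relation.Binary.PropositionalEquality using (_≡_; _≢_)
open import Relation.Nullary using (Dec; ¬_)
open import Relation.Nullary.Decidable using (¬?)
open import Data.Nat.Properties using (_≟_)
import Data.Vec.Properties as VP
open import Data.Bool.Properties using () renaming (_≟_ to _≟ᵇ_)

-- The vector space F₂^n, with F₂ represented by Bool (false = 0, true = 1,
-- addition = xor, multiplication = ∧).
V : ℕ → Set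
V n = Vec Bool n

𝟎 : (n : ℕ) → V n
𝟎 n = replicate n false

_⊕_ : {n : ℕ} → V n → V n → V n
_⊕_ = zipWith _xor_

⟨_,_⟩ : {n : ℕ} → V n → V n → Bool
⟨ [] , [] ⟩ = false
⟨ x ∷ xs , y ∷ ys ⟩ = (x ∧ y) xor ⟨ xs , ys ⟩

allV : (n : ℕ) → List (V n)
allV zero = [] ∷ []
allV (suc n) = concatMap (λ v → (false ∷ v) ∷ (true ∷ v) ∷ []) (allV n)

sign : Bool → ℤ
sign false = ℤ.+ 1
sign true = ℤ.-[1+ 0 ]

W : {n : ℕ} → (V n → Bool) → V n → ℤ
W {n} f a = foldr (λ x acc → sign (f x xor ⟨ a , x ⟩) ℤ.+ acc) (ℤ.+ 0) (allV n)

component : {n : ℕ} → (V n → V n) → V n → (V n → Bool)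
component F b x = ⟨ b , F x ⟩

IsPlateauedWith : {n : ℕ} → ℕ → (V n → Bool) → Set
IsPlateauedWith {n} t f =
  ∃ λ k → (n + t ≡ 2 * k) × (∀ a → ∣ W f a ∣ ≡ 0 ⊎ ∣ W f a ∣ ≡ 2 ^ k)

IsPlateauedFun : {n : ℕ} → (V n → V n) → Set
IsPlateauedFun {n} F = ∀ b → b ≢ 𝟎 n → ∃ λ s → IsPlateauedWith s (component F b)

IsAPN : {n : ℕ} → (V n → V n) → Set
IsAPN {n} F = ∀ a → a ≢ 𝟎 n → ∀ b →
  length (filter (λ x → VP.≡-dec _≟ᵇ_ (F (x ⊕ a) ⊕ F x) b) (allV n)) ≤ 2

IsBent : (m : ℕ) → (V (2 * m) → Bool) → Set
IsBent m f = All (λ a → ∣ W f a ∣ ≡ 2 ^ m) (allV (2 * m))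

isBent? : (m : ℕ) → (f : V (2 * m) → Bool) → Dec (IsBent m f)
isBent? m f = all? (λ a → ∣ W f a ∣ ≟ 2 ^ m) (allV (2 * m))

nonzeroV : (n : ℕ) → List (V n)
nonzeroV n = filter (λ b → ¬? (VP.≡-dec _≟ᵇ_ b (𝟎 n))) (allV n)

numBentComponents : (m : ℕ) → (V (2 * m) → V (2 * m)) → ℕ
numBentComponents m F = length (filter (λ b → isBent? m (component F b)) (nonzeroV (2 * m)))

-- Count ∑_b ∑_a W_{F_b}(a)⁴ in two ways.  Parseval applied twice turns it into
-- 2^{2n} · #{(d, x, z) : D_d F(x) = D_d F(z)}, where D_d F(x) = F(x + d) + F(x); for APN F
-- every d ≠ 0 and x admit exactly the two solutions z ∈ {x, x + d}, so the sum is 2^{3n}(3 · 2^n − 2).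
-- Component by component, b = 0 contributes 2^{4n}, a bent component 2^{3n}, and a non-bent
-- plateaued component with |W| ∈ {0, 2^k}, k > n/2, contributes 2^{2k+2n}, a multiple of 4 · 2^{3n}.
-- Dividing by 2^{3n}: 2^n + #bent + 4R = 3 · 2^n − 2, hence #bent ≡ 2 (mod 4) because 4 ∣ 2^n.

module Submission where

open import Defs
open import Algebra.Bundles using (CommutativeRing)
open import Data.Bool using (Bool; true; false; _xor_; _∧_; not; if_then_else_)
open import Data.Bool.Properties
  using (xor-comm; xor-assoc; xor-same; xor-identityˡ; xor-identityʳ; ∧-comm; ∧-distribˡ-xor; xor-∧-commutativeRing)
  renaming (_≟_ to _≟ᵇ_)
open import Data.Empty using (⊥-elim)
open import Data.Integer using (ℤ; +_; -[1+_]; 0ℤ; 1ℤ; _+_; _-_; -_; _*_; ∣_∣; _≤_; +≤+)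
import Data.Integer.Properties as ℤₚ
open import Data.Integer.Tactic.RingSolver using (solve-∀)
open import Data.List using (List; []; _∷_; _++_; foldr; concatMap; filter; length)
open import Data.List.Relation.Unary.All as All using (All; []; _∷_)
open import Data.List.Relation.Unary.All.Properties using (all-filter)
open import Data.Nat as ℕ using (ℕ; zero; suc)
open import Data.Nat.DivMod using ([m+kn]%n≡m%n)
import Data.Nat.Properties as ℕₚ
open import Data.Product using (∃; _×_; _,_; proj₁; proj₂)
open import Data.Sum using (_⊎_; inj₁; inj₂)
open import Data.Vec using ([]; _∷_)
open import Data.Vec.Properties using (≡-dec)
open import Data.Vec.Relation.Binary.Pointwise.Inductive
  using (Pointwise-≡⇒≡; zipWith-comm; zipWith-assoc; zipWith-identityˡ; zipWith-identityʳ)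
open import Relation.Binary.PropositionalEquality
open import Relation.Nullary using (¬_; Dec; yes; no; does)
open import Relation.Nullary.Decidable using (¬?; dec-true; dec-false)
open import Algebra.Properties.CommutativeSemigroup ℤₚ.+-commutativeSemigroup
  using () renaming (interchange to +-interchange)
open import Algebra.Properties.CommutativeSemigroup
  (CommutativeRing.+-commutativeSemigroup xor-∧-commutativeRing) using () renaming (interchange to xor-interchange)
open ≡-Reasoning

-- The same fold as in W, so that W f a is definitionally ∑[ x ∈ allV n ] sign (f x xor ⟨ a , x ⟩).
∑ : {A : Set} → List A → (A → ℤ) → ℤ
∑ xs g = foldr (λ x acc → g x + acc) 0ℤ xs

∑-syntax : {A : Set} → List A → (A → ℤ) → ℤ
∑-syntax = ∑

infix 5 ∑-syntax
syntax ∑-syntax xs (λ x → e) = ∑[ x ∈ xs ] e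

module _ {A : Set} where

  ∑-congᴬ : ∀ {xs : List A} {g h : A → ℤ} → All (λ x → g x ≡ h x) xs → ∑ xs g ≡ ∑ xs h
  ∑-congᴬ [] = refl
  ∑-congᴬ (e ∷ es) = cong₂ _+_ e (∑-congᴬ es)

  ∑-cong : ∀ (xs : List A) {g h : A → ℤ} → (∀ x → g x ≡ h x) → ∑ xs g ≡ ∑ xs h
  ∑-cong xs e = ∑-congᴬ (All.universal e xs)

  ∑-zero : ∀ (xs : List A) → ∑[ x ∈ xs ] 0ℤ ≡ 0ℤ
  ∑-zero [] = refl
  ∑-zero (x ∷ xs) = trans (ℤₚ.+-identityˡ _) (∑-zero xs)

  ∑-+ : ∀ (xs : List A) (g h : A → ℤ) → ∑[ x ∈ xs ] (g x + h x) ≡ ∑ xs g + ∑ xs h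
  ∑-+ [] g h = refl
  ∑-+ (x ∷ xs) g h = trans (cong (_+_ (g x + h x)) (∑-+ xs g h)) (+-interchange (g x) (h x) (∑ xs g) (∑ xs h))

  ∑-neg : ∀ (xs : List A) (g : A → ℤ) → ∑[ x ∈ xs ] (- g x) ≡ - ∑ xs g
  ∑-neg [] g = refl
  ∑-neg (x ∷ xs) g = trans (cong (_+_ (- g x)) (∑-neg xs g)) (sym (ℤₚ.neg-distrib-+ (g x) (∑ xs g)))

  ∑-*ˡ : ∀ (xs : List A) (c : ℤ) (g : A → ℤ) → ∑[ x ∈ xs ] (c * g x) ≡ c * ∑ xs g
  ∑-*ˡ [] c g = sym (ℤₚ.*-zeroʳ c)
  ∑-*ˡ (x ∷ xs) c g = trans (cong (_+_ (c * g x)) (∑-*ˡ xs c g)) (sym (ℤₚ.*-distribˡ-+ c (g x) (∑ xs g)))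

  ∑-*ʳ : ∀ (xs : List A) (c : ℤ) (g : A → ℤ) → ∑[ x ∈ xs ] (g x * c) ≡ ∑ xs g * c
  ∑-*ʳ xs c g = begin
    ∑[ x ∈ xs ] (g x * c) ≡⟨ ∑-cong xs (λ x → ℤₚ.*-comm (g x) c) ⟩
    ∑[ x ∈ xs ] (c * g x) ≡⟨ ∑-*ˡ xs c g ⟩
    c * ∑ xs g            ≡⟨ ℤₚ.*-comm c (∑ xs g) ⟩
    ∑ xs g * c            ∎

  ∑-const : ∀ (xs : List A) (c : ℤ) → ∑[ x ∈ xs ] c ≡ + length xs * c
  ∑-const [] c = refl
  ∑-const (x ∷ xs) c = begin
    c + (∑[ y ∈ xs ] c) ≡⟨ cong (_+_ c) (∑-const xs c) ⟩
    c + + length xs * c ≡⟨ cong (_+ + length xs * c) (sym (ℤₚ.*-identityˡ c)) ⟩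
    1ℤ * c + + length xs * c ≡⟨ sym (ℤₚ.*-distribʳ-+ c 1ℤ (+ length xs)) ⟩
    + suc (length xs) * c ∎

  ∑-++ : ∀ (xs ys : List A) (g : A → ℤ) → ∑ (xs ++ ys) g ≡ ∑ xs g + ∑ ys g
  ∑-++ [] ys g = sym (ℤₚ.+-identityˡ (∑ ys g))
  ∑-++ (x ∷ xs) ys g = trans (cong (_+_ (g x)) (∑-++ xs ys g)) (sym (ℤₚ.+-assoc (g x) (∑ xs g) (∑ ys g)))

  ∑-mono-≤ : ∀ (xs : List A) {g h : A → ℤ} → (∀ x → g x ≤ h x) → ∑ xs g ≤ ∑ xs h
  ∑-mono-≤ [] le = ℤₚ.≤-refl
  ∑-mono-≤ (x ∷ xs) le = ℤₚ.+-mono-≤ (le x) (∑-mono-≤ xs le)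

  ∑-nonneg-≡0 : ∀ (xs : List A) (g : A → ℤ) → (∀ x → 0ℤ ≤ g x) → ∑ xs g ≡ 0ℤ → All (λ x → g x ≡ 0ℤ) xs
  ∑-nonneg-≡0 [] g nonneg eq = []
  ∑-nonneg-≡0 (x ∷ xs) g nonneg eq = head≡0 ∷ ∑-nonneg-≡0 xs g nonneg tail≡0
    where
    0≤tail : 0ℤ ≤ ∑ xs g
    0≤tail = subst (_≤ ∑ xs g) (∑-zero xs) (∑-mono-≤ xs nonneg)
    head≡0 : g x ≡ 0ℤ
    head≡0 = ℤₚ.≤-antisym (subst₂ _≤_ (ℤₚ.+-identityʳ (g x)) eq (ℤₚ.+-monoʳ-≤ (g x) 0≤tail)) (nonneg x)
    tail≡0 : ∑ xs g ≡ 0ℤ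
    tail≡0 = trans (sym (ℤₚ.+-identityˡ (∑ xs g))) (trans (cong (_+ ∑ xs g) (sym head≡0)) eq)

∑-concatMap : ∀ {A B : Set} (f : A → List B) (xs : List A) (g : B → ℤ) →
  ∑ (concatMap f xs) g ≡ ∑[ x ∈ xs ] ∑ (f x) g
∑-concatMap f [] g = refl
∑-concatMap f (x ∷ xs) g = trans (∑-++ (f x) (concatMap f xs) g) (cong (_+_ (∑ (f x) g)) (∑-concatMap f xs g))

∑-swap : ∀ {A B : Set} (xs : List A) (ys : List B) (g : A → B → ℤ) →
  ∑[ x ∈ xs ] ∑[ y ∈ ys ] g x y ≡ ∑[ y ∈ ys ] ∑[ x ∈ xs ] g x y
∑-swap [] ys g = sym (∑-zero ys)
∑-swap (x ∷ xs) ys g = begin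
  ∑ ys (g x) + (∑[ x′ ∈ xs ] ∑[ y ∈ ys ] g x′ y) ≡⟨ cong (_+_ (∑ ys (g x))) (∑-swap xs ys g) ⟩
  ∑ ys (g x) + (∑[ y ∈ ys ] ∑[ x′ ∈ xs ] g x′ y) ≡⟨ sym (∑-+ ys (g x) (λ y → ∑[ x′ ∈ xs ] g x′ y)) ⟩
  ∑[ y ∈ ys ] g x y + (∑[ x′ ∈ xs ] g x′ y)      ∎

∑-product : ∀ {A B : Set} (xs : List A) (ys : List B) (g : A → ℤ) (h : B → ℤ) →
  ∑ xs g * ∑ ys h ≡ ∑[ x ∈ xs ] ∑[ y ∈ ys ] g x * h y
∑-product xs ys g h =
  trans (sym (∑-*ʳ xs (∑ ys h) g)) (∑-cong xs (λ x → sym (∑-*ˡ ys (g x) h)))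

-- Defined through does, so that 𝟙 ((b ∷ x) ≟ᵥ (c ∷ y)) reduces to 𝟙 (x ≟ᵥ y) or 0ℤ for concrete b, c.
𝟙 : {P : Set} → Dec P → ℤ
𝟙 P? = if does P? then 1ℤ else 0ℤ

𝟙-yes : {P : Set} (P? : Dec P) → P → 𝟙 P? ≡ 1ℤ
𝟙-yes P? p rewrite dec-true P? p = refl

𝟙-no : {P : Set} (P? : Dec P) → ¬ P → 𝟙 P? ≡ 0ℤ
𝟙-no P? ¬p rewrite dec-false P? ¬p = refl

𝟙-¬ : {P : Set} (P? : Dec P) → 𝟙 (¬? P?) ≡ 1ℤ - 𝟙 P?
𝟙-¬ (yes _) = refl
𝟙-¬ (no _) = refl

0≤𝟙 : {P : Set} (P? : Dec P) → 0ℤ ≤ 𝟙 P?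
0≤𝟙 (yes _) = +≤+ ℕ.z≤n
0≤𝟙 (no _) = ℤₚ.≤-refl

𝟙*𝟙 : {P : Set} (P? : Dec P) → 𝟙 P? * 𝟙 P? ≡ 𝟙 P?
𝟙*𝟙 (yes _) = refl
𝟙*𝟙 (no _) = refl

𝟙-cong : {P Q : Set} (P? : Dec P) (Q? : Dec Q) → (P → Q) → (Q → P) → 𝟙 P? ≡ 𝟙 Q?
𝟙-cong (yes p) Q? P→Q Q→P = sym (𝟙-yes Q? (P→Q p))
𝟙-cong (no ¬p) Q? P→Q Q→P = sym (𝟙-no Q? (λ q → ¬p (Q→P q)))

∑-𝟙 : ∀ {A : Set} {P : A → Set} (P? : ∀ x → Dec (P x)) (xs : List A) (g : A → ℤ) →
  ∑ (filter P? xs) g ≡ ∑[ x ∈ xs ] 𝟙 (P? x) * g x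
∑-𝟙 P? [] g = refl
∑-𝟙 P? (x ∷ xs) g with does (P? x)
... | true = cong₂ _+_ (sym (ℤₚ.*-identityˡ (g x))) (∑-𝟙 P? xs g)
... | false = trans (∑-𝟙 P? xs g) (sym (ℤₚ.+-identityˡ _))

∑-𝟙≡length-filter : ∀ {A : Set} {P : A → Set} (P? : ∀ x → Dec (P x)) (xs : List A) →
  ∑[ x ∈ xs ] 𝟙 (P? x) ≡ + length (filter P? xs)
∑-𝟙≡length-filter P? xs = begin
  ∑[ x ∈ xs ] 𝟙 (P? x)               ≡⟨ ∑-cong xs (λ x → sym (ℤₚ.*-identityʳ (𝟙 (P? x)))) ⟩
  ∑[ x ∈ xs ] 𝟙 (P? x) * 1ℤ          ≡⟨ sym (∑-𝟙 P? xs (λ _ → 1ℤ)) ⟩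
  ∑[ x ∈ filter P? xs ] 1ℤ           ≡⟨ ∑-const (filter P? xs) 1ℤ ⟩
  + length (filter P? xs) * 1ℤ       ≡⟨ ℤₚ.*-identityʳ (+ length (filter P? xs)) ⟩
  + length (filter P? xs)            ∎

infix 4 _≟ᵥ_

_≟ᵥ_ : ∀ {n} (x y : V n) → Dec (x ≡ y)
_≟ᵥ_ = ≡-dec _≟ᵇ_

⊕-comm : ∀ {n} (x y : V n) → x ⊕ y ≡ y ⊕ x
⊕-comm x y = Pointwise-≡⇒≡ (zipWith-comm xor-comm x y)

⊕-assoc : ∀ {n} (x y z : V n) → (x ⊕ y) ⊕ z ≡ x ⊕ (y ⊕ z)
⊕-assoc x y z = Pointwise-≡⇒≡ (zipWith-assoc xor-assoc x y z)

⊕-identityˡ : ∀ {n} (x : V n) → 𝟎 n ⊕ x ≡ x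
⊕-identityˡ x = Pointwise-≡⇒≡ (zipWith-identityˡ xor-identityˡ x)

⊕-identityʳ : ∀ {n} (x : V n) → x ⊕ 𝟎 n ≡ x
⊕-identityʳ x = Pointwise-≡⇒≡ (zipWith-identityʳ xor-identityʳ x)

⊕-self : ∀ {n} (x : V n) → x ⊕ x ≡ 𝟎 n
⊕-self [] = refl
⊕-self (b ∷ x) = cong₂ _∷_ (xor-same b) (⊕-self x)

⊕-cancelʳ : ∀ {n} (x y : V n) → (x ⊕ y) ⊕ y ≡ x
⊕-cancelʳ x y = begin
  (x ⊕ y) ⊕ y ≡⟨ ⊕-assoc x y y ⟩
  x ⊕ (y ⊕ y) ≡⟨ cong (x ⊕_) (⊕-self y) ⟩
  x ⊕ 𝟎 _     ≡⟨ ⊕-identityʳ x ⟩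
  x           ∎

⊕-cancelˡ : ∀ {n} (x y : V n) → x ⊕ (x ⊕ y) ≡ y
⊕-cancelˡ x y = begin
  x ⊕ (x ⊕ y) ≡⟨ sym (⊕-assoc x x y) ⟩
  (x ⊕ x) ⊕ y ≡⟨ cong (_⊕ y) (⊕-self x) ⟩
  𝟎 _ ⊕ y     ≡⟨ ⊕-identityˡ y ⟩
  y           ∎

⊕≡𝟎⇒≡ : ∀ {n} (x y : V n) → x ⊕ y ≡ 𝟎 n → x ≡ y
⊕≡𝟎⇒≡ x y eq = trans (sym (⊕-cancelʳ x y)) (trans (cong (_⊕ y) eq) (⊕-identityˡ y))

⟨⟩-comm : ∀ {n} (x y : V n) → ⟨ x , y ⟩ ≡ ⟨ y , x ⟩
⟨⟩-comm [] [] = refl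
⟨⟩-comm (a ∷ x) (b ∷ y) = cong₂ _xor_ (∧-comm a b) (⟨⟩-comm x y)

⟨⟩-⊕ʳ : ∀ {n} (a x y : V n) → ⟨ a , x ⊕ y ⟩ ≡ ⟨ a , x ⟩ xor ⟨ a , y ⟩
⟨⟩-⊕ʳ [] [] [] = refl
⟨⟩-⊕ʳ (a ∷ as) (x ∷ xs) (y ∷ ys) =
  trans (cong₂ _xor_ (∧-distribˡ-xor a x y) (⟨⟩-⊕ʳ as xs ys))
        (xor-interchange (a ∧ x) (a ∧ y) ⟨ as , xs ⟩ ⟨ as , ys ⟩)

⟨𝟎,⟩ : ∀ {n} (x : V n) → ⟨ 𝟎 n , x ⟩ ≡ false
⟨𝟎,⟩ [] = refl
⟨𝟎,⟩ (b ∷ x) = ⟨𝟎,⟩ x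

card : ℕ → ℤ
card n = + (2 ℕ.^ n)

card-+ : ∀ m n → card (m ℕ.+ n) ≡ card m * card n
card-+ m n = trans (cong +_ (ℕₚ.^-distribˡ-+-* 2 m n)) (ℤₚ.pos-* (2 ℕ.^ m) (2 ℕ.^ n))

card-suc : ∀ n → card (suc n) ≡ + 2 * card n
card-suc n = ℤₚ.pos-* 2 (2 ℕ.^ n)

card-double : ∀ m → card (2 ℕ.* m) ≡ card m * card m
card-double m = trans (cong card (cong (m ℕ.+_) (ℕₚ.+-identityʳ m))) (card-+ m m)

card≢0 : ∀ n → card n ≢ 0ℤ
card≢0 n eq = ℕₚ.<⇒≢ (ℕₚ.m^n>0 2 n) (sym (ℤₚ.+-injective eq))

∑-allV-suc : ∀ n (g : V (suc n) → ℤ) →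
  ∑ (allV (suc n)) g ≡ ∑[ v ∈ allV n ] g (false ∷ v) + g (true ∷ v)
∑-allV-suc n g = trans (∑-concatMap (λ v → (false ∷ v) ∷ (true ∷ v) ∷ []) (allV n) g)
  (∑-cong (allV n) (λ v → cong (_+_ (g (false ∷ v))) (ℤₚ.+-identityʳ (g (true ∷ v)))))

∑-allV-const : ∀ n (c : ℤ) → ∑[ x ∈ allV n ] c ≡ card n * c
∑-allV-const zero c = trans (ℤₚ.+-identityʳ c) (sym (ℤₚ.*-identityˡ c))
∑-allV-const (suc n) c = begin
  ∑[ x ∈ allV (suc n) ] c ≡⟨ ∑-allV-suc n (λ _ → c) ⟩
  ∑[ x ∈ allV n ] c + c   ≡⟨ ∑-allV-const n (c + c) ⟩
  card n * (c + c)        ≡⟨ double (card n) c ⟩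
  (+ 2 * card n) * c      ≡⟨ cong (_* c) (sym (card-suc n)) ⟩
  card (suc n) * c        ∎
  where
  double : ∀ p c → p * (c + c) ≡ (+ 2 * p) * c
  double = solve-∀

∑-allV-translate : ∀ n (c : V n) (g : V n → ℤ) → ∑[ x ∈ allV n ] g (x ⊕ c) ≡ ∑ (allV n) g
∑-allV-translate zero [] g = refl
∑-allV-translate (suc n) (false ∷ c) g = begin
  ∑[ x ∈ allV (suc n) ] g (x ⊕ (false ∷ c))               ≡⟨ ∑-allV-suc n (λ x → g (x ⊕ (false ∷ c))) ⟩
  ∑[ v ∈ allV n ] g (false ∷ (v ⊕ c)) + g (true ∷ (v ⊕ c)) ≡⟨ ∑-allV-translate n c (λ v → g (false ∷ v) + g (true ∷ v)) ⟩
  ∑[ v ∈ allV n ] g (false ∷ v) + g (true ∷ v)             ≡⟨ sym (∑-allV-suc n g) ⟩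
  ∑ (allV (suc n)) g                                       ∎
∑-allV-translate (suc n) (true ∷ c) g = begin
  ∑[ x ∈ allV (suc n) ] g (x ⊕ (true ∷ c))                 ≡⟨ ∑-allV-suc n (λ x → g (x ⊕ (true ∷ c))) ⟩
  ∑[ v ∈ allV n ] g (true ∷ (v ⊕ c)) + g (false ∷ (v ⊕ c)) ≡⟨ ∑-cong (allV n) (λ v → ℤₚ.+-comm (g (true ∷ (v ⊕ c))) _) ⟩
  ∑[ v ∈ allV n ] g (false ∷ (v ⊕ c)) + g (true ∷ (v ⊕ c)) ≡⟨ ∑-allV-translate n c (λ v → g (false ∷ v) + g (true ∷ v)) ⟩
  ∑[ v ∈ allV n ] g (false ∷ v) + g (true ∷ v)             ≡⟨ sym (∑-allV-suc n g) ⟩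
  ∑ (allV (suc n)) g                                       ∎

∑-sift : ∀ n (h : V n → ℤ) (x : V n) → ∑[ y ∈ allV n ] h y * 𝟙 (y ≟ᵥ x) ≡ h x
∑-sift zero h [] = trans (ℤₚ.+-identityʳ (h [] * 1ℤ)) (ℤₚ.*-identityʳ (h []))
∑-sift (suc n) h (false ∷ x) = begin
  ∑[ y ∈ allV (suc n) ] h y * 𝟙 (y ≟ᵥ (false ∷ x))         ≡⟨ ∑-allV-suc n (λ y → h y * 𝟙 (y ≟ᵥ _)) ⟩
  ∑[ y ∈ allV n ] h (false ∷ y) * 𝟙 (y ≟ᵥ x) + h (true ∷ y) * 0ℤ
    ≡⟨ ∑-cong (allV n) (λ y → drop-right (h (false ∷ y) * 𝟙 (y ≟ᵥ x)) (h (true ∷ y))) ⟩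
  ∑[ y ∈ allV n ] h (false ∷ y) * 𝟙 (y ≟ᵥ x)               ≡⟨ ∑-sift n (λ y → h (false ∷ y)) x ⟩
  h (false ∷ x)                                            ∎
  where
  drop-right : ∀ a b → a + b * 0ℤ ≡ a
  drop-right = solve-∀
∑-sift (suc n) h (true ∷ x) = begin
  ∑[ y ∈ allV (suc n) ] h y * 𝟙 (y ≟ᵥ (true ∷ x))          ≡⟨ ∑-allV-suc n (λ y → h y * 𝟙 (y ≟ᵥ _)) ⟩
  ∑[ y ∈ allV n ] h (false ∷ y) * 0ℤ + h (true ∷ y) * 𝟙 (y ≟ᵥ x)
    ≡⟨ ∑-cong (allV n) (λ y → drop-left (h (false ∷ y)) (h (true ∷ y) * 𝟙 (y ≟ᵥ x))) ⟩
  ∑[ y ∈ allV n ] h (true ∷ y) * 𝟙 (y ≟ᵥ x)                ≡⟨ ∑-sift n (λ y → h (true ∷ y)) x ⟩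
  h (true ∷ x)                                             ∎
  where
  drop-left : ∀ a b → a * 0ℤ + b ≡ b
  drop-left = solve-∀

∑-𝟙-point : ∀ n (x : V n) → ∑[ y ∈ allV n ] 𝟙 (y ≟ᵥ x) ≡ 1ℤ
∑-𝟙-point n x = trans (∑-cong (allV n) (λ y → sym (ℤₚ.*-identityˡ (𝟙 (y ≟ᵥ x))))) (∑-sift n (λ _ → 1ℤ) x)

sign-xor : ∀ p q → sign (p xor q) ≡ sign p * sign q
sign-xor true true = refl
sign-xor true false = refl
sign-xor false q = sym (ℤₚ.*-identityˡ (sign q))

sign*sign : ∀ p → sign p * sign p ≡ 1ℤ
sign*sign true = refl
sign*sign false = refl

sign+sign-not : ∀ p → sign p + sign (not p) ≡ 0ℤ
sign+sign-not true = refl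
sign+sign-not false = refl

χ : ∀ {n} → V n → V n → ℤ
χ a x = sign ⟨ a , x ⟩

χ-comm : ∀ {n} (a x : V n) → χ a x ≡ χ x a
χ-comm a x = cong sign (⟨⟩-comm a x)

χ-⊕ : ∀ {n} (a x y : V n) → χ a x * χ a y ≡ χ a (x ⊕ y)
χ-⊕ a x y = trans (sym (sign-xor ⟨ a , x ⟩ ⟨ a , y ⟩)) (cong sign (sym (⟨⟩-⊕ʳ a x y)))

weighted-χ-product : ∀ {n} (a x y : V n) (s t : ℤ) → (s * χ a x) * (t * χ a y) ≡ s * t * χ a (x ⊕ y)
weighted-χ-product a x y s t = trans (rearrange s (χ a x) t (χ a y)) (cong (s * t *_) (χ-⊕ a x y))
  where
  rearrange : ∀ a b c d → (a * b) * (c * d) ≡ (a * c) * (b * d)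
  rearrange = solve-∀

δ : ∀ {n} → V n → ℤ
δ {n} a = 𝟙 (a ≟ᵥ 𝟎 n)

∑-χ : ∀ n (a : V n) → ∑[ b ∈ allV n ] χ b a ≡ card n * δ a
∑-χ zero [] = refl
∑-χ (suc n) (false ∷ a) = begin
  ∑[ b ∈ allV (suc n) ] χ b (false ∷ a) ≡⟨ ∑-allV-suc n (λ b → χ b (false ∷ a)) ⟩
  ∑[ b ∈ allV n ] χ b a + χ b a          ≡⟨ ∑-+ (allV n) (λ b → χ b a) (λ b → χ b a) ⟩
  (∑[ b ∈ allV n ] χ b a) + (∑[ b ∈ allV n ] χ b a) ≡⟨ cong₂ _+_ (∑-χ n a) (∑-χ n a) ⟩
  card n * δ a + card n * δ a            ≡⟨ double (card n) (δ a) ⟩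
  (+ 2 * card n) * δ a                   ≡⟨ cong (_* δ a) (sym (card-suc n)) ⟩
  card (suc n) * δ a                     ∎
  where
  double : ∀ p d → p * d + p * d ≡ (+ 2 * p) * d
  double = solve-∀
∑-χ (suc n) (true ∷ a) = begin
  ∑[ b ∈ allV (suc n) ] χ b (true ∷ a)                   ≡⟨ ∑-allV-suc n (λ b → χ b (true ∷ a)) ⟩
  ∑[ b ∈ allV n ] sign ⟨ b , a ⟩ + sign (not ⟨ b , a ⟩)   ≡⟨ ∑-cong (allV n) (λ b → sign+sign-not ⟨ b , a ⟩) ⟩
  ∑[ b ∈ allV n ] 0ℤ                                     ≡⟨ ∑-zero (allV n) ⟩
  0ℤ                                                     ≡⟨ sym (ℤₚ.*-zeroʳ (card (suc n))) ⟩
  card (suc n) * 0ℤ                                      ∎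

walsh : ∀ {n} → (V n → ℤ) → V n → ℤ
walsh {n} g a = ∑[ x ∈ allV n ] g x * χ a x

∑-character-sums-product : ∀ {n} {A B : Set} (xs : List A) (ys : List B)
  (u : A → V n) (v : B → V n) (g : A → ℤ) (h : B → ℤ) →
  ∑[ b ∈ allV n ] (∑[ x ∈ xs ] g x * χ b (u x)) * (∑[ y ∈ ys ] h y * χ b (v y))
  ≡ card n * (∑[ x ∈ xs ] ∑[ y ∈ ys ] g x * h y * 𝟙 (v y ≟ᵥ u x))
∑-character-sums-product {n} xs ys u v g h = begin
  ∑[ b ∈ allV n ] (∑[ x ∈ xs ] g x * χ b (u x)) * (∑[ y ∈ ys ] h y * χ b (v y))
    ≡⟨ ∑-cong (allV n) (λ b → trans (∑-product xs ys (λ x → g x * χ b (u x)) (λ y → h y * χ b (v y)))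
                                 (∑-cong xs (λ x → ∑-cong ys (λ y → weighted-χ-product b (u x) (v y) (g x) (h y))))) ⟩
  ∑[ b ∈ allV n ] ∑[ x ∈ xs ] ∑[ y ∈ ys ] g x * h y * χ b (u x ⊕ v y)
    ≡⟨ ∑-swap (allV n) xs (λ b x → ∑[ y ∈ ys ] g x * h y * χ b (u x ⊕ v y)) ⟩
  ∑[ x ∈ xs ] ∑[ b ∈ allV n ] ∑[ y ∈ ys ] g x * h y * χ b (u x ⊕ v y)
    ≡⟨ ∑-cong xs (λ x → ∑-swap (allV n) ys (λ b y → g x * h y * χ b (u x ⊕ v y))) ⟩
  ∑[ x ∈ xs ] ∑[ y ∈ ys ] ∑[ b ∈ allV n ] g x * h y * χ b (u x ⊕ v y)
    ≡⟨ ∑-cong xs (λ x → ∑-cong ys (λ y → orthogonal x y)) ⟩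
  ∑[ x ∈ xs ] ∑[ y ∈ ys ] card n * (g x * h y * 𝟙 (v y ≟ᵥ u x))
    ≡⟨ ∑-cong xs (λ x → ∑-*ˡ ys (card n) (λ y → g x * h y * 𝟙 (v y ≟ᵥ u x))) ⟩
  ∑[ x ∈ xs ] card n * (∑[ y ∈ ys ] g x * h y * 𝟙 (v y ≟ᵥ u x))
    ≡⟨ ∑-*ˡ xs (card n) (λ x → ∑[ y ∈ ys ] g x * h y * 𝟙 (v y ≟ᵥ u x)) ⟩
  card n * (∑[ x ∈ xs ] ∑[ y ∈ ys ] g x * h y * 𝟙 (v y ≟ᵥ u x)) ∎
  where
  δ-⊕ : ∀ x y → δ (u x ⊕ v y) ≡ 𝟙 (v y ≟ᵥ u x)
  δ-⊕ x y = 𝟙-cong (u x ⊕ v y ≟ᵥ 𝟎 n) (v y ≟ᵥ u x)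
    (λ eq → sym (⊕≡𝟎⇒≡ (u x) (v y) eq)) (λ eq → trans (cong (_⊕ v y) (sym eq)) (⊕-self (v y)))
  orthogonal : ∀ x y → ∑[ b ∈ allV n ] g x * h y * χ b (u x ⊕ v y) ≡ card n * (g x * h y * 𝟙 (v y ≟ᵥ u x))
  orthogonal x y = begin
    ∑[ b ∈ allV n ] g x * h y * χ b (u x ⊕ v y) ≡⟨ ∑-*ˡ (allV n) (g x * h y) (λ b → χ b (u x ⊕ v y)) ⟩
    g x * h y * (∑[ b ∈ allV n ] χ b (u x ⊕ v y)) ≡⟨ cong (g x * h y *_) (trans (∑-χ n _) (cong (card n *_) (δ-⊕ x y))) ⟩
    g x * h y * (card n * 𝟙 (v y ≟ᵥ u x))         ≡⟨ swap (g x * h y) (card n) _ ⟩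
    card n * (g x * h y * 𝟙 (v y ≟ᵥ u x))         ∎
    where
    swap : ∀ a p i → a * (p * i) ≡ p * (a * i)
    swap = solve-∀

walsh-parseval : ∀ n (g h : V n → ℤ) →
  ∑[ a ∈ allV n ] walsh g a * walsh h a ≡ card n * (∑[ x ∈ allV n ] g x * h x)
walsh-parseval n g h = begin
  ∑[ a ∈ allV n ] walsh g a * walsh h a
    ≡⟨ ∑-character-sums-product (allV n) (allV n) (λ x → x) (λ y → y) g h ⟩
  card n * (∑[ x ∈ allV n ] ∑[ y ∈ allV n ] g x * h y * 𝟙 (y ≟ᵥ x))
    ≡⟨ cong (card n *_) (∑-cong (allV n) (λ x → ∑-sift n (λ y → g x * h y) x)) ⟩
  card n * (∑[ x ∈ allV n ] g x * h x) ∎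

walsh*walsh≡walsh-correlation : ∀ n (g h : V n → ℤ) (a : V n) →
  walsh g a * walsh h a ≡ walsh (λ d → ∑[ x ∈ allV n ] g x * h (d ⊕ x)) a
walsh*walsh≡walsh-correlation n g h a = begin
  walsh g a * walsh h a
    ≡⟨ ∑-product (allV n) (allV n) (λ x → g x * χ a x) (λ y → h y * χ a y) ⟩
  ∑[ x ∈ allV n ] ∑[ y ∈ allV n ] (g x * χ a x) * (h y * χ a y)
    ≡⟨ ∑-cong (allV n) (λ x → ∑-cong (allV n) (λ y → weighted-χ-product a x y (g x) (h y))) ⟩
  ∑[ x ∈ allV n ] ∑[ y ∈ allV n ] g x * h y * χ a (x ⊕ y)
    ≡⟨ ∑-cong (allV n) (λ x → sym (∑-allV-translate n x (λ y → g x * h y * χ a (x ⊕ y)))) ⟩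
  ∑[ x ∈ allV n ] ∑[ d ∈ allV n ] g x * h (d ⊕ x) * χ a (x ⊕ (d ⊕ x))
    ≡⟨ ∑-cong (allV n) (λ x → ∑-cong (allV n) (λ d → cong (λ w → g x * h (d ⊕ x) * χ a w) (x⊕[d⊕x]≡d x d))) ⟩
  ∑[ x ∈ allV n ] ∑[ d ∈ allV n ] g x * h (d ⊕ x) * χ a d
    ≡⟨ ∑-swap (allV n) (allV n) (λ x d → g x * h (d ⊕ x) * χ a d) ⟩
  ∑[ d ∈ allV n ] ∑[ x ∈ allV n ] g x * h (d ⊕ x) * χ a d
    ≡⟨ ∑-cong (allV n) (λ d → ∑-*ʳ (allV n) (χ a d) (λ x → g x * h (d ⊕ x))) ⟩
  walsh (λ d → ∑[ x ∈ allV n ] g x * h (d ⊕ x)) a ∎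
  where
  x⊕[d⊕x]≡d : ∀ x d → x ⊕ (d ⊕ x) ≡ d
  x⊕[d⊕x]≡d x d = trans (cong (x ⊕_) (⊕-comm d x)) (⊕-cancelˡ x d)

W≡walsh-sign : ∀ {n} (f : V n → Bool) (a : V n) → W f a ≡ walsh (λ x → sign (f x)) a
W≡walsh-sign {n} f a = ∑-cong (allV n) (λ x → sign-xor (f x) ⟨ a , x ⟩)

autocorrelation : ∀ {n} → (V n → Bool) → V n → ℤ
autocorrelation {n} f d = ∑[ x ∈ allV n ] sign (f x) * sign (f (d ⊕ x))

W²≡walsh-autocorrelation : ∀ {n} (f : V n → Bool) (a : V n) → W f a * W f a ≡ walsh (autocorrelation f) a
W²≡walsh-autocorrelation {n} f a =
  trans (cong₂ _*_ (W≡walsh-sign f a) (W≡walsh-sign f a)) (walsh*walsh≡walsh-correlation n (λ x → sign (f x)) (λ x → sign (f x)) a)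

∑W²≡card² : ∀ {n} (f : V n → Bool) → ∑[ a ∈ allV n ] W f a * W f a ≡ card n * card n
∑W²≡card² {n} f = begin
  ∑[ a ∈ allV n ] W f a * W f a
    ≡⟨ ∑-cong (allV n) (λ a → cong₂ _*_ (W≡walsh-sign f a) (W≡walsh-sign f a)) ⟩
  ∑[ a ∈ allV n ] walsh (λ x → sign (f x)) a * walsh (λ x → sign (f x)) a
    ≡⟨ walsh-parseval n (λ x → sign (f x)) (λ x → sign (f x)) ⟩
  card n * (∑[ x ∈ allV n ] sign (f x) * sign (f x))
    ≡⟨ cong (card n *_) (trans (∑-cong (allV n) (λ x → sign*sign (f x))) (∑-allV-const n 1ℤ)) ⟩
  card n * (card n * 1ℤ)
    ≡⟨ cong (card n *_) (ℤₚ.*-identityʳ (card n)) ⟩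
  card n * card n ∎

fourthMoment : ∀ {n} → (V n → Bool) → ℤ
fourthMoment {n} f = ∑[ a ∈ allV n ] (W f a * W f a) * (W f a * W f a)

fourthMoment≡∑autocorrelation² : ∀ {n} (f : V n → Bool) →
  fourthMoment f ≡ card n * (∑[ d ∈ allV n ] autocorrelation f d * autocorrelation f d)
fourthMoment≡∑autocorrelation² {n} f =
  trans (∑-cong (allV n) (λ a → cong₂ _*_ (W²≡walsh-autocorrelation f a) (W²≡walsh-autocorrelation f a)))
        (walsh-parseval n (autocorrelation f) (autocorrelation f))

∣i∣≡m⇒i*i≡m*m : ∀ (i : ℤ) {m} → ∣ i ∣ ≡ m → i * i ≡ + m * + m
∣i∣≡m⇒i*i≡m*m (+ k) refl = refl
∣i∣≡m⇒i*i≡m*m -[1+ k ] refl = ℤₚ.pos-* (suc k) (suc k)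

square-of-two-valued : ∀ {x c : ℤ} → x ≡ 0ℤ ⊎ x ≡ c → x * x ≡ c * x
square-of-two-valued {c = c} (inj₁ refl) = sym (ℤₚ.*-zeroʳ c)
square-of-two-valued (inj₂ refl) = refl

W²-two-valued : ∀ {n} (f : V n → Bool) k a → ∣ W f a ∣ ≡ 0 ⊎ ∣ W f a ∣ ≡ 2 ℕ.^ k →
  W f a * W f a ≡ 0ℤ ⊎ W f a * W f a ≡ card k * card k
W²-two-valued f k a (inj₁ eq) = inj₁ (∣i∣≡m⇒i*i≡m*m (W f a) eq)
W²-two-valued f k a (inj₂ eq) = inj₂ (∣i∣≡m⇒i*i≡m*m (W f a) eq)

fourthMoment-two-valued : ∀ {n} (f : V n → Bool) k →
  All (λ a → ∣ W f a ∣ ≡ 0 ⊎ ∣ W f a ∣ ≡ 2 ℕ.^ k) (allV n) →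
  fourthMoment f ≡ card k * card k * (card n * card n)
fourthMoment-two-valued {n} f k two-valued = begin
  fourthMoment f
    ≡⟨ ∑-congᴬ (All.map (λ {a} level → square-of-two-valued (W²-two-valued f k a level)) two-valued) ⟩
  ∑[ a ∈ allV n ] card k * card k * (W f a * W f a)
    ≡⟨ ∑-*ˡ (allV n) (card k * card k) (λ a → W f a * W f a) ⟩
  card k * card k * (∑[ a ∈ allV n ] W f a * W f a)
    ≡⟨ cong (card k * card k *_) (∑W²≡card² f) ⟩
  card k * card k * (card n * card n) ∎

fourthMoment-bent : ∀ m (f : V (2 ℕ.* m) → Bool) → IsBent m f →
  fourthMoment f ≡ card (2 ℕ.* m) * (card (2 ℕ.* m) * card (2 ℕ.* m))
fourthMoment-bent m f bent = begin
  fourthMoment f                                  ≡⟨ fourthMoment-two-valued f m (All.map inj₂ bent) ⟩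
  card m * card m * (card n * card n)             ≡⟨ cong (_* (card n * card n)) (sym (card-double m)) ⟩
  card n * (card n * card n)                      ∎
  where
  n = 2 ℕ.* m

-- By Parseval the gaps 2^n − W f a², each 0 or 2^n, sum to zero.
two-valued-at-half⇒bent : ∀ m (f : V (2 ℕ.* m) → Bool) →
  (∀ a → ∣ W f a ∣ ≡ 0 ⊎ ∣ W f a ∣ ≡ 2 ℕ.^ m) → IsBent m f
two-valued-at-half⇒bent m f two-valued =
  All.map (λ {a} → level≡half a) (∑-nonneg-≡0 (allV n) gap 0≤gap ∑gap≡0)
  where
  n = 2 ℕ.* m
  gap : V n → ℤ
  gap a = card n - W f a * W f a
  gap-at-zero : ∀ a → ∣ W f a ∣ ≡ 0 → gap a ≡ card n
  gap-at-zero a eq = trans (cong (λ t → card n - t) (∣i∣≡m⇒i*i≡m*m (W f a) eq)) (ℤₚ.+-identityʳ (card n))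
  gap-at-half : ∀ a → ∣ W f a ∣ ≡ 2 ℕ.^ m → gap a ≡ 0ℤ
  gap-at-half a eq = trans (cong (λ t → card n - t) (trans (∣i∣≡m⇒i*i≡m*m (W f a) eq) (sym (card-double m))))
                           (ℤₚ.+-inverseʳ (card n))
  0≤gap : ∀ a → 0ℤ ≤ gap a
  0≤gap a with two-valued a
  ... | inj₁ eq = subst (0ℤ ≤_) (sym (gap-at-zero a eq)) (+≤+ ℕ.z≤n)
  ... | inj₂ eq = subst (0ℤ ≤_) (sym (gap-at-half a eq)) ℤₚ.≤-refl
  ∑gap≡0 : ∑ (allV n) gap ≡ 0ℤ
  ∑gap≡0 = begin
    ∑ (allV n) gap
      ≡⟨ ∑-+ (allV n) (λ _ → card n) (λ a → - (W f a * W f a)) ⟩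
    (∑[ a ∈ allV n ] card n) + (∑[ a ∈ allV n ] - (W f a * W f a))
      ≡⟨ cong₂ _+_ (∑-allV-const n (card n)) (trans (∑-neg (allV n) (λ a → W f a * W f a)) (cong -_ (∑W²≡card² f))) ⟩
    card n * card n - card n * card n
      ≡⟨ ℤₚ.+-inverseʳ (card n * card n) ⟩
    0ℤ ∎
  level≡half : ∀ a → gap a ≡ 0ℤ → ∣ W f a ∣ ≡ 2 ℕ.^ m
  level≡half a gap≡0 with two-valued a
  ... | inj₁ eq = ⊥-elim (card≢0 n (trans (sym (gap-at-zero a eq)) gap≡0))
  ... | inj₂ eq = eq

-- n + s = 2k forces k ≥ m, and k = m would make f bent; so k = m + 1 + j and 2^{2k} = 4 · 2^n · 4^j.
fourthMoment-plateaued-not-bent : ∀ m s (f : V (2 ℕ.* m) → Bool) → IsPlateauedWith s f → ¬ IsBent m f →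
  ∃ λ r → fourthMoment f ≡ + 4 * (card (2 ℕ.* m) * (card (2 ℕ.* m) * card (2 ℕ.* m))) * r
fourthMoment-plateaued-not-bent m s f (k , n+s≡2k , two-valued) not-bent with k ℕ.≟ m
... | yes refl = ⊥-elim (not-bent (two-valued-at-half⇒bent m f two-valued))
... | no k≢m = card j * card j , (begin
  fourthMoment f
    ≡⟨ fourthMoment-two-valued f k (All.universal two-valued (allV n)) ⟩
  card k * card k * (card n * card n)
    ≡⟨ cong₂ (λ x y → x * x * (y * y)) card-k (card-double m) ⟩
  (+ 2 * card m * card j) * (+ 2 * card m * card j) * ((card m * card m) * (card m * card m))
    ≡⟨ regroup (card m) (card j) ⟩
  + 4 * ((card m * card m) * ((card m * card m) * (card m * card m))) * (card j * card j)
    ≡⟨ cong (λ x → + 4 * (x * (x * x)) * (card j * card j)) (sym (card-double m)) ⟩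
  + 4 * (card n * (card n * card n)) * (card j * card j) ∎)
  where
  n = 2 ℕ.* m
  m<k : m ℕ.< k
  m<k = ℕₚ.≤∧≢⇒< (ℕₚ.*-cancelˡ-≤ 2 (subst (n ℕ.≤_) n+s≡2k (ℕₚ.m≤m+n n s))) (λ m≡k → k≢m (sym m≡k))
  j = k ℕ.∸ suc m
  card-k : card k ≡ + 2 * card m * card j
  card-k = begin
    card k                 ≡⟨ cong card (sym (ℕₚ.m+[n∸m]≡n m<k)) ⟩
    card (suc m ℕ.+ j)     ≡⟨ card-+ (suc m) j ⟩
    card (suc m) * card j  ≡⟨ cong (_* card j) (card-suc m) ⟩
    + 2 * card m * card j  ∎
  regroup : ∀ a b → (+ 2 * a * b) * (+ 2 * a * b) * ((a * a) * (a * a)) ≡ + 4 * ((a * a) * ((a * a) * (a * a))) * (b * b)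
  regroup = solve-∀

Δ : ∀ {n} → (V n → V n) → V n → V n → V n
Δ F d x = F (x ⊕ d) ⊕ F x

Δ-translate : ∀ {n} (F : V n → V n) (d x : V n) → Δ F d (x ⊕ d) ≡ Δ F d x
Δ-translate F d x = trans (cong (λ w → F w ⊕ F (x ⊕ d)) (⊕-cancelʳ x d)) (⊕-comm (F x) (F (x ⊕ d)))

Δ-𝟎 : ∀ {n} (F : V n → V n) (x : V n) → Δ F (𝟎 n) x ≡ 𝟎 n
Δ-𝟎 F x = trans (cong (λ w → F w ⊕ F x) (⊕-identityʳ x)) (⊕-self (F x))

collisions : ∀ {n} → (V n → V n) → V n → V n → ℤ
collisions {n} F d x = ∑[ z ∈ allV n ] 𝟙 (Δ F d z ≟ᵥ Δ F d x)

collisions-𝟎 : ∀ {n} (F : V n → V n) (x : V n) → collisions F (𝟎 n) x ≡ card n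
collisions-𝟎 {n} F x = begin
  collisions F (𝟎 n) x ≡⟨ ∑-cong (allV n) (λ z → 𝟙-yes (Δ F (𝟎 n) z ≟ᵥ Δ F (𝟎 n) x) (trans (Δ-𝟎 F z) (sym (Δ-𝟎 F x)))) ⟩
  ∑[ z ∈ allV n ] 1ℤ   ≡⟨ ∑-allV-const n 1ℤ ⟩
  card n * 1ℤ          ≡⟨ ℤₚ.*-identityʳ (card n) ⟩
  card n               ∎

collisions≤2 : ∀ {n} (F : V n → V n) → IsAPN F → ∀ d → d ≢ 𝟎 n → ∀ x → collisions F d x ≤ + 2
collisions≤2 {n} F apn d d≢0 x =
  subst (_≤ + 2) (sym (∑-𝟙≡length-filter (λ z → Δ F d z ≟ᵥ Δ F d x) (allV n))) (+≤+ (apn d d≢0 (Δ F d x)))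

2≤collisions : ∀ {n} (F : V n → V n) → ∀ d → d ≢ 𝟎 n → ∀ x → + 2 ≤ collisions F d x
2≤collisions {n} F d d≢0 x = subst (_≤ collisions F d x) two (∑-mono-≤ (allV n) x-and-x⊕d-collide)
  where
  x-and-x⊕d-collide : ∀ z → 𝟙 (z ≟ᵥ x) + 𝟙 (z ≟ᵥ x ⊕ d) ≤ 𝟙 (Δ F d z ≟ᵥ Δ F d x)
  x-and-x⊕d-collide z with z ≟ᵥ x | z ≟ᵥ x ⊕ d
  ... | yes refl | yes z≡z⊕d = ⊥-elim (d≢0 (begin
    d           ≡⟨ sym (⊕-cancelˡ z d) ⟩
    z ⊕ (z ⊕ d) ≡⟨ cong (z ⊕_) (sym z≡z⊕d) ⟩
    z ⊕ z       ≡⟨ ⊕-self z ⟩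
    𝟎 n         ∎))
  ... | yes refl | no _ = subst (+ 1 ≤_) (sym (𝟙-yes (Δ F d z ≟ᵥ Δ F d z) refl)) ℤₚ.≤-refl
  ... | no _ | yes refl = subst (+ 1 ≤_) (sym (𝟙-yes (Δ F d (x ⊕ d) ≟ᵥ Δ F d x) (Δ-translate F d x))) ℤₚ.≤-refl
  ... | no _ | no _ = 0≤𝟙 (Δ F d z ≟ᵥ Δ F d x)
  two : ∑[ z ∈ allV n ] 𝟙 (z ≟ᵥ x) + 𝟙 (z ≟ᵥ x ⊕ d) ≡ + 2
  two = trans (∑-+ (allV n) (λ z → 𝟙 (z ≟ᵥ x)) (λ z → 𝟙 (z ≟ᵥ x ⊕ d)))
              (cong₂ _+_ (∑-𝟙-point n x) (∑-𝟙-point n (x ⊕ d)))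

collisions-APN : ∀ {n} (F : V n → V n) → IsAPN F → ∀ d x →
  collisions F d x ≡ card n * δ d + + 2 * (1ℤ - δ d)
collisions-APN {n} F apn d x with d ≟ᵥ 𝟎 n
... | yes refl = trans (collisions-𝟎 F x) (at-one (card n))
  where
  at-one : ∀ p → p ≡ p * 1ℤ + + 2 * (1ℤ - 1ℤ)
  at-one = solve-∀
... | no d≢0 = trans (ℤₚ.≤-antisym (collisions≤2 F apn d d≢0 x) (2≤collisions F d d≢0 x)) (at-zero (card n))
  where
  at-zero : ∀ p → + 2 ≡ p * 0ℤ + + 2 * (1ℤ - 0ℤ)
  at-zero = solve-∀

∑-collisions-APN : ∀ {n} (F : V n → V n) → IsAPN F →
  ∑[ d ∈ allV n ] ∑[ x ∈ allV n ] collisions F d x ≡ card n * (+ 3 * card n - + 2)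
∑-collisions-APN {n} F apn = begin
  ∑[ d ∈ allV n ] ∑[ x ∈ allV n ] collisions F d x
    ≡⟨ ∑-cong (allV n) (λ d → trans (∑-cong (allV n) (collisions-APN F apn d)) (∑-allV-const n _)) ⟩
  ∑[ d ∈ allV n ] card n * (card n * δ d + + 2 * (1ℤ - δ d))
    ≡⟨ ∑-cong (allV n) (λ d → expand (card n) (δ d)) ⟩
  ∑[ d ∈ allV n ] card n * (card n - + 2) * δ d + card n * + 2
    ≡⟨ ∑-+ (allV n) (λ d → card n * (card n - + 2) * δ d) (λ _ → card n * + 2) ⟩
  (∑[ d ∈ allV n ] card n * (card n - + 2) * δ d) + (∑[ d ∈ allV n ] card n * + 2)
    ≡⟨ cong₂ _+_ (∑-sift n (λ _ → card n * (card n - + 2)) (𝟎 n)) (∑-allV-const n (card n * + 2)) ⟩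
  card n * (card n - + 2) + card n * (card n * + 2)
    ≡⟨ collect (card n) ⟩
  card n * (+ 3 * card n - + 2) ∎
  where
  expand : ∀ p i → p * (p * i + + 2 * (1ℤ - i)) ≡ p * (p - + 2) * i + p * + 2
  expand = solve-∀
  collect : ∀ p → p * (p - + 2) + p * (p * + 2) ≡ p * (+ 3 * p - + 2)
  collect = solve-∀

autocorrelation-component : ∀ {n} (F : V n → V n) (b d : V n) →
  autocorrelation (component F b) d ≡ ∑[ x ∈ allV n ] 1ℤ * χ b (Δ F d x)
autocorrelation-component {n} F b d = ∑-cong (allV n) (λ x → begin
  χ b (F x) * χ b (F (d ⊕ x)) ≡⟨ χ-⊕ b (F x) (F (d ⊕ x)) ⟩
  χ b (F x ⊕ F (d ⊕ x))       ≡⟨ cong (χ b) (trans (⊕-comm (F x) (F (d ⊕ x))) (cong (λ w → F w ⊕ F x) (⊕-comm d x))) ⟩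
  χ b (Δ F d x)               ≡⟨ sym (ℤₚ.*-identityˡ (χ b (Δ F d x))) ⟩
  1ℤ * χ b (Δ F d x)          ∎)

∑-fourthMoment-components : ∀ {n} (F : V n → V n) →
  ∑[ b ∈ allV n ] fourthMoment (component F b)
  ≡ card n * (card n * (∑[ d ∈ allV n ] ∑[ x ∈ allV n ] collisions F d x))
∑-fourthMoment-components {n} F = begin
  ∑[ b ∈ allV n ] fourthMoment (component F b)
    ≡⟨ ∑-cong (allV n) (λ b → fourthMoment≡∑autocorrelation² (component F b)) ⟩
  ∑[ b ∈ allV n ] card n * (∑[ d ∈ allV n ] C b d * C b d)
    ≡⟨ ∑-*ˡ (allV n) (card n) (λ b → ∑[ d ∈ allV n ] C b d * C b d) ⟩
  card n * (∑[ b ∈ allV n ] ∑[ d ∈ allV n ] C b d * C b d)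
    ≡⟨ cong (card n *_) (∑-swap (allV n) (allV n) (λ b d → C b d * C b d)) ⟩
  card n * (∑[ d ∈ allV n ] ∑[ b ∈ allV n ] C b d * C b d)
    ≡⟨ cong (card n *_) (∑-cong (allV n) ∑-over-components) ⟩
  card n * (∑[ d ∈ allV n ] card n * (∑[ x ∈ allV n ] collisions F d x))
    ≡⟨ cong (card n *_) (∑-*ˡ (allV n) (card n) (λ d → ∑[ x ∈ allV n ] collisions F d x)) ⟩
  card n * (card n * (∑[ d ∈ allV n ] ∑[ x ∈ allV n ] collisions F d x)) ∎
  where
  C : V n → V n → ℤ
  C b = autocorrelation (component F b)
  ∑-over-components : ∀ d → ∑[ b ∈ allV n ] C b d * C b d ≡ card n * (∑[ x ∈ allV n ] collisions F d x)
  ∑-over-components d = begin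
    ∑[ b ∈ allV n ] C b d * C b d
      ≡⟨ ∑-cong (allV n) (λ b → cong₂ _*_ (autocorrelation-component F b d) (autocorrelation-component F b d)) ⟩
    ∑[ b ∈ allV n ] (∑[ x ∈ allV n ] 1ℤ * χ b (Δ F d x)) * (∑[ z ∈ allV n ] 1ℤ * χ b (Δ F d z))
      ≡⟨ ∑-character-sums-product (allV n) (allV n) (Δ F d) (Δ F d) (λ _ → 1ℤ) (λ _ → 1ℤ) ⟩
    card n * (∑[ x ∈ allV n ] ∑[ z ∈ allV n ] 1ℤ * 𝟙 (Δ F d z ≟ᵥ Δ F d x))
      ≡⟨ cong (card n *_) (∑-cong (allV n) (λ x → ∑-cong (allV n) (λ z → ℤₚ.*-identityˡ (𝟙 (Δ F d z ≟ᵥ Δ F d x))))) ⟩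
    card n * (∑[ x ∈ allV n ] collisions F d x) ∎

W-component-𝟎 : ∀ {n} (F : V n → V n) (a : V n) → W (component F (𝟎 n)) a ≡ card n * δ a
W-component-𝟎 {n} F a = begin
  W (component F (𝟎 n)) a ≡⟨ ∑-cong (allV n) (λ x → cong (λ t → sign (t xor ⟨ a , x ⟩)) (⟨𝟎,⟩ (F x))) ⟩
  ∑[ x ∈ allV n ] χ a x   ≡⟨ ∑-cong (allV n) (χ-comm a) ⟩
  ∑[ x ∈ allV n ] χ x a   ≡⟨ ∑-χ n a ⟩
  card n * δ a            ∎

fourthMoment-component-𝟎 : ∀ {n} (F : V n → V n) →
  fourthMoment (component F (𝟎 n)) ≡ card n * card n * (card n * card n)
fourthMoment-component-𝟎 {n} F = begin
  fourthMoment (component F (𝟎 n))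
    ≡⟨ ∑-cong (allV n) (λ a → trans (cong (λ t → (t * t) * (t * t)) (W-component-𝟎 F a)) (fourth-power (card n) (δ a))) ⟩
  ∑[ a ∈ allV n ] c⁴ * ((δ a * δ a) * (δ a * δ a))
    ≡⟨ ∑-cong (allV n) (λ a → cong (λ t → c⁴ * (t * t)) (𝟙*𝟙 (a ≟ᵥ 𝟎 n))) ⟩
  ∑[ a ∈ allV n ] c⁴ * (δ a * δ a)
    ≡⟨ ∑-cong (allV n) (λ a → cong (c⁴ *_) (𝟙*𝟙 (a ≟ᵥ 𝟎 n))) ⟩
  ∑[ a ∈ allV n ] c⁴ * δ a
    ≡⟨ ∑-sift n (λ _ → c⁴) (𝟎 n) ⟩
  c⁴ ∎
  where
  c⁴ = card n * card n * (card n * card n)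
  fourth-power : ∀ p i → (p * i * (p * i)) * (p * i * (p * i)) ≡ p * p * (p * p) * ((i * i) * (i * i))
  fourth-power = solve-∀

∑-allV≡𝟎+nonzero : ∀ n (g : V n → ℤ) → ∑ (allV n) g ≡ g (𝟎 n) + ∑ (nonzeroV n) g
∑-allV≡𝟎+nonzero n g = begin
  ∑ (allV n) g
    ≡⟨ ∑-cong (allV n) (λ b → split (g b) (δ b)) ⟩
  ∑[ b ∈ allV n ] g b * δ b + (1ℤ - δ b) * g b
    ≡⟨ ∑-+ (allV n) (λ b → g b * δ b) (λ b → (1ℤ - δ b) * g b) ⟩
  (∑[ b ∈ allV n ] g b * δ b) + (∑[ b ∈ allV n ] (1ℤ - δ b) * g b)
    ≡⟨ cong₂ _+_ (∑-sift n g (𝟎 n)) (∑-cong (allV n) (λ b → cong (_* g b) (sym (𝟙-¬ (b ≟ᵥ 𝟎 n))))) ⟩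
  g (𝟎 n) + (∑[ b ∈ allV n ] 𝟙 (¬? (b ≟ᵥ 𝟎 n)) * g b)
    ≡⟨ cong (_+_ (g (𝟎 n))) (sym (∑-𝟙 (λ b → ¬? (b ≟ᵥ 𝟎 n)) (allV n) g)) ⟩
  g (𝟎 n) + ∑ (nonzeroV n) g ∎
  where
  split : ∀ x i → x ≡ x * i + (1ℤ - i) * x
  split = solve-∀

∑-count : ∀ {A : Set} {B : A → Set} (B? : ∀ x → Dec (B x)) (xs : List A) (g : A → ℤ) (c d : ℤ) →
  All (λ x → (B x → g x ≡ c) × (¬ B x → ∃ λ r → g x ≡ d * r)) xs →
  ∃ λ R → ∑ xs g ≡ c * + length (filter B? xs) + d * R
∑-count B? [] g c d [] = 0ℤ , nothing c d
  where
  nothing : ∀ c d → 0ℤ ≡ c * 0ℤ + d * 0ℤ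
  nothing = solve-∀
∑-count B? (x ∷ xs) g c d ((if-B , if-¬B) ∷ rest) with ∑-count B? xs g c d rest | B? x
... | R , eq | yes bx = R , (begin
  g x + ∑ xs g                                     ≡⟨ cong₂ _+_ (if-B bx) eq ⟩
  c + (c * + length (filter B? xs) + d * R)        ≡⟨ one-more c (+ length (filter B? xs)) d R ⟩
  c * (1ℤ + + length (filter B? xs)) + d * R       ∎)
  where
  one-more : ∀ c L d R → c + (c * L + d * R) ≡ c * (1ℤ + L) + d * R
  one-more = solve-∀
... | R , eq | no ¬bx with if-¬B ¬bx
... | r , eq′ = r + R , (begin
  g x + ∑ xs g                                     ≡⟨ cong₂ _+_ eq′ eq ⟩
  d * r + (c * + length (filter B? xs) + d * R)    ≡⟨ absorb c (+ length (filter B? xs)) d r R ⟩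
  c * + length (filter B? xs) + d * (r + R)        ∎)
  where
  absorb : ∀ c L d r R → d * r + (c * L + d * R) ≡ c * L + d * (r + R)
  absorb = solve-∀

%4≡2 : ∀ L K → + L ≡ + 4 * K + + 2 → L ℕ.% 4 ≡ 2
%4≡2 L (+ k) eq = begin
  L ℕ.% 4                 ≡⟨ cong (ℕ._% 4) L≡ ⟩
  (2 ℕ.+ k ℕ.* 4) ℕ.% 4   ≡⟨ [m+kn]%n≡m%n 2 k 4 ⟩
  2                       ∎
  where
  L≡ : L ≡ 2 ℕ.+ k ℕ.* 4
  L≡ = ℤₚ.+-injective (begin
    + L                   ≡⟨ eq ⟩
    + 4 * + k + + 2       ≡⟨ cong (_+ + 2) (sym (ℤₚ.pos-* 4 k)) ⟩
    + (4 ℕ.* k ℕ.+ 2)     ≡⟨ cong +_ (trans (ℕₚ.+-comm (4 ℕ.* k) 2) (cong (2 ℕ.+_) (ℕₚ.*-comm 4 k))) ⟩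
    + (2 ℕ.+ k ℕ.* 4)     ∎)
%4≡2 L -[1+ k ] eq with trans eq (trans (negative (+ k)) (cong (λ t → - (+ 2 + t)) (sym (ℤₚ.pos-* 4 k))))
  where
  negative : ∀ x → + 4 * (- (1ℤ + x)) + + 2 ≡ - (+ 2 + + 4 * x)
  negative = solve-∀
... | ()

balance⇒%4≡2 : ∀ (p q : ℤ) L R → p ≡ + 4 * q → p + + L + + 4 * R ≡ + 3 * p - + 2 → L ℕ.% 4 ≡ 2
balance⇒%4≡2 p q L R refl eq = %4≡2 L (+ 2 * q - R - 1ℤ) (begin
  + L
    ≡⟨ isolate q (+ L) R ⟩
  + 4 * (+ 2 * q - R - 1ℤ) + + 2 + ((+ 4 * q + + L + + 4 * R) - (+ 3 * (+ 4 * q) - + 2))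
    ≡⟨ cong (λ t → + 4 * (+ 2 * q - R - 1ℤ) + + 2 + (t - (+ 3 * (+ 4 * q) - + 2))) eq ⟩
  + 4 * (+ 2 * q - R - 1ℤ) + + 2 + ((+ 3 * (+ 4 * q) - + 2) - (+ 3 * (+ 4 * q) - + 2))
    ≡⟨ cancel q R ⟩
  + 4 * (+ 2 * q - R - 1ℤ) + + 2 ∎)
  where
  isolate : ∀ q L R → L ≡ + 4 * (+ 2 * q - R - 1ℤ) + + 2 + ((+ 4 * q + L + + 4 * R) - (+ 3 * (+ 4 * q) - + 2))
  isolate = solve-∀
  cancel : ∀ q R → + 4 * (+ 2 * q - R - 1ℤ) + + 2 + ((+ 3 * (+ 4 * q) - + 2) - (+ 3 * (+ 4 * q) - + 2))
                   ≡ + 4 * (+ 2 * q - R - 1ℤ) + + 2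
  cancel = solve-∀

card-cancelˡ : ∀ n {x y : ℤ} → card n * x ≡ card n * y → x ≡ y
card-cancelˡ n {x} {y} = ℤₚ.*-cancelˡ-≡ (card n) x y {{ℕₚ.m^n≢0 2 n}}

card-double-suc : ∀ m → card (2 ℕ.* suc m) ≡ + 4 * (card m * card m)
card-double-suc m = begin
  card (2 ℕ.* suc m)                  ≡⟨ card-double (suc m) ⟩
  card (suc m) * card (suc m)         ≡⟨ cong (λ t → t * t) (card-suc m) ⟩
  (+ 2 * card m) * (+ 2 * card m)     ≡⟨ square-of-double (card m) ⟩
  + 4 * (card m * card m)             ∎
  where
  square-of-double : ∀ a → (+ 2 * a) * (+ 2 * a) ≡ + 4 * (a * a)
  square-of-double = solve-∀

nonzero-component-dichotomy : ∀ m (F : V (2 ℕ.* m) → V (2 ℕ.* m)) → IsPlateauedFun F →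
  let p = card (2 ℕ.* m) in
  All (λ b → (IsBent m (component F b) → fourthMoment (component F b) ≡ p * (p * p))
           × (¬ IsBent m (component F b) → ∃ λ r → fourthMoment (component F b) ≡ + 4 * (p * (p * p)) * r))
      (nonzeroV (2 ℕ.* m))
nonzero-component-dichotomy m F plateaued =
  All.map (λ {b} b≢0 → fourthMoment-bent m (component F b) ,
                       fourthMoment-plateaued-not-bent m _ (component F b) (proj₂ (plateaued b b≢0)))
          (all-filter (λ b → ¬? (b ≟ᵥ 𝟎 (2 ℕ.* m))) (allV (2 ℕ.* m)))

proposition6p5 : (m : ℕ) → m ℕ.≥ 1 → (F : V (2 ℕ.* m) → V (2 ℕ.* m)) →
    IsPlateauedFun F → IsAPN F → numBentComponents m F ℕ.% 4 ≡ 2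
proposition6p5 m@(suc m′) _ F plateaued apn =
  balance⇒%4≡2 p (card m′ * card m′) L R (card-double-suc m′)
    (card-cancelˡ n (card-cancelˡ n (card-cancelˡ n balance)))
  where
  n = 2 ℕ.* m
  p = card n
  L = numBentComponents m F
  fM : V n → ℤ
  fM b = fourthMoment (component F b)
  counted = ∑-count (λ b → isBent? m (component F b)) (nonzeroV n) fM (p * (p * p)) (+ 4 * (p * (p * p)))
                    (nonzero-component-dichotomy m F plateaued)
  R = proj₁ counted
  balance : p * (p * (p * (p + + L + + 4 * R))) ≡ p * (p * (p * (+ 3 * p - + 2)))
  balance = begin
    p * (p * (p * (p + + L + + 4 * R)))
      ≡⟨ expand p (+ L) R ⟩
    p * p * (p * p) + (p * (p * p) * + L + + 4 * (p * (p * p)) * R)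
      ≡⟨ cong₂ _+_ (sym (fourthMoment-component-𝟎 F)) (sym (proj₂ counted)) ⟩
    fM (𝟎 n) + ∑ (nonzeroV n) fM
      ≡⟨ sym (∑-allV≡𝟎+nonzero n fM) ⟩
    ∑ (allV n) fM
      ≡⟨ ∑-fourthMoment-components F ⟩
    p * (p * (∑[ d ∈ allV n ] ∑[ x ∈ allV n ] collisions F d x))
      ≡⟨ cong (λ t → p * (p * t)) (∑-collisions-APN F apn) ⟩
    p * (p * (p * (+ 3 * p - + 2))) ∎
    where
    expand : ∀ p L R → p * (p * (p * (p + L + + 4 * R))) ≡ p * p * (p * p) + (p * (p * p) * L + + 4 * (p * (p * p)) * R)
    expand = solve-∀
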